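{- If $(t_k)$ and $(\tau_k)$, $k=0,1,2,\ldots$, are a binomial-transform pair of the first kind, then so are the sequences \[ a_k=\frac{1}{(k+1)(k+2)}\sum_{j=0}^k t_j\quad\text{and}\quad \alpha_k=\frac{1}{(k+1)(k+2)}\sum_{j=0}^k\tau_j,\qquad k=0,1,2,\ldots. \]
   Context: Two sequences $(t_k)_{k\ge0}$ and $(\tau_k)_{k\ge0}$ of complex numbers form a binomial-transform pair of the first kind if $\tau_n=\sum_{k=0}^n(-1)^k\binom nk t_k$ for every non-negative integer $n$. -}

module Defs where

open import Level using (Level)
open import Data.Nat using (ℕ; zero; suc)
open import Data.Nat.Combinatorics using (_C_)
open import Algebra.Bundles using (CommutativeRing)

module BinomialDefs {c ℓ : Level} (R : CommutativeRing c ℓ) where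
  open CommutativeRing R hiding (zero)

  ι : ℕ → Carrier
  ι zero = 0#
  ι (suc n) = 1# + ι n

  sgn : ℕ → Carrier
  sgn zero = 1#
  sgn (suc k) = - sgn k

  sumTo : ℕ → (ℕ → Carrier) → Carrier
  sumTo zero f = f zero
  sumTo (suc n) f = sumTo n f + f (suc n)

  IsBinomialPair : (ℕ → Carrier) → (ℕ → Carrier) → Set ℓ
  IsBinomialPair t τ = ∀ n → τ n ≈ sumTo n (λ k → sgn k * (ι (n C k) * t k))

  -- given inv with inv n = 1/(n+1):  s_k = 1/((k+1)(k+2)) Σ_{j=0}^k t_j
  avg : (inv : ℕ → Carrier) → (ℕ → Carrier) → ℕ → Carrier
  avg inv t k = (inv k * inv (suc k)) * sumTo k t

{-# OPTIONS --safe #-}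
module Submission where

-- Write T f n = Σ_{k ≤ n} (-1)^k C(n,k) f_k, and read terms with negative index as 0. Pascal's rule gives
-- T f (n+1) = T f n - T (f ∘ suc) n, and the absorption identity (k+1) C(n+1,k+1) = (n+1) C(n,k) gives
-- T (k ↦ k f_k) (n+1) = -(n+1) T (f ∘ suc) n. Applied twice, it shows that (n+1)(n+2) T a n is the transform at
-- n+2 of k ↦ k(k-1) a_{k-2}, which by the choice of a is the sequence of partial sums S_{k-2} = Σ_{j ≤ k-2} t_j.
-- Consecutive terms of that sequence differ by t_{k-1}, so Pascal's rule turns its transform into
-- -T (k ↦ t_{k-1}) (n+1) = Σ_{m ≤ n} τ_m.

open import Defs
open import Level using (Level)
open import Algebra.Bundles using (CommutativeRing)
open import Data.Nat as ℕ using (ℕ; zero; suc; s≤s; z≤n)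
import Data.Nat.Properties as ℕₚ
open import Data.Nat.Combinatorics using (_C_; nCk+nC[k+1]≡[n+1]C[k+1]; nC1≡n)
open import Data.Nat.Combinatorics.Specification using (k>n⇒nCk≡0)
open import Function using (_∘_)
open import Relation.Binary.PropositionalEquality as ≡ using (_≡_)

[k+1]*[n+1]C[k+1]≡[n+1]*nCk : ∀ n k → suc k ℕ.* (suc n C suc k) ≡ suc n ℕ.* (n C k)
[k+1]*[n+1]C[k+1]≡[n+1]*nCk zero zero = ≡.refl
[k+1]*[n+1]C[k+1]≡[n+1]*nCk zero (suc k)
  rewrite k>n⇒nCk≡0 {1} (s≤s (s≤s (z≤n {k}))) | k>n⇒nCk≡0 {0} (s≤s (z≤n {k}))
  = ℕₚ.*-zeroʳ (suc (suc k))
[k+1]*[n+1]C[k+1]≡[n+1]*nCk (suc n) zero =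
  ≡.trans (ℕₚ.*-identityˡ _) (≡.trans (nC1≡n (suc (suc n))) (≡.sym (ℕₚ.*-identityʳ _)))
[k+1]*[n+1]C[k+1]≡[n+1]*nCk (suc n) (suc k) = begin
  suc (suc k) ℕ.* (suc (suc n) C suc (suc k))   ≡⟨ ≡.cong (suc (suc k) ℕ.*_) (nCk+nC[k+1]≡[n+1]C[k+1] (suc n) (suc k)) ⟨
  suc (suc k) ℕ.* (a ℕ.+ b)                     ≡⟨ ℕₚ.*-distribˡ-+ (suc (suc k)) a b ⟩
  (a ℕ.+ suc k ℕ.* a) ℕ.+ suc (suc k) ℕ.* b     ≡⟨ ℕₚ.+-assoc a _ _ ⟩
  a ℕ.+ (suc k ℕ.* a ℕ.+ suc (suc k) ℕ.* b)     ≡⟨ ≡.cong (a ℕ.+_) (≡.cong₂ ℕ._+_ ih ih′) ⟩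
  a ℕ.+ (suc n ℕ.* (n C k) ℕ.+ suc n ℕ.* (n C suc k)) ≡⟨ ≡.cong (a ℕ.+_) (ℕₚ.*-distribˡ-+ (suc n) (n C k) (n C suc k)) ⟨
  a ℕ.+ suc n ℕ.* (n C k ℕ.+ n C suc k)         ≡⟨ ≡.cong (λ m → a ℕ.+ suc n ℕ.* m) (nCk+nC[k+1]≡[n+1]C[k+1] n k) ⟩
  suc (suc n) ℕ.* a                             ∎
  where
  open ≡.≡-Reasoning
  a b : ℕ
  a = suc n C suc k
  b = suc n C suc (suc k)
  ih : suc k ℕ.* a ≡ suc n ℕ.* (n C k)
  ih = [k+1]*[n+1]C[k+1]≡[n+1]*nCk n k
  ih′ : suc (suc k) ℕ.* b ≡ suc n ℕ.* (n C suc k)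
  ih′ = [k+1]*[n+1]C[k+1]≡[n+1]*nCk n (suc k)

module BinomialTransform {c ℓ : Level} (R : CommutativeRing c ℓ) where
  open CommutativeRing R hiding (zero)
  open BinomialDefs R
  open import Algebra.Properties.Ring ring
    using (-‿distribˡ-*; -‿distribʳ-*; -‿involutive; -‿+-comm; \\-leftDividesˡ)
  open import Algebra.Properties.Semiring.Mult semiring using (_×_; ×-homo-+; ×1-homo-*)
  open import Algebra.Properties.CommutativeSemigroup +-commutativeSemigroup using (interchange)
  open import Algebra.Properties.CommutativeSemigroup *-commutativeSemigroup
    using (x∙yz≈y∙xz; x∙yz≈yx∙z) renaming (interchange to *-interchange)
  open import Relation.Binary.Reasoning.Setoid setoid

  ι≡×1# : ∀ n → ι n ≡ n × 1#
  ι≡×1# zero = ≡.refl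
  ι≡×1# (suc n) = ≡.cong (1# +_) (ι≡×1# n)

  ι-+ : ∀ m n → ι (m ℕ.+ n) ≈ ι m + ι n
  ι-+ m n rewrite ι≡×1# (m ℕ.+ n) | ι≡×1# m | ι≡×1# n = ×-homo-+ 1# m n

  ι-* : ∀ m n → ι (m ℕ.* n) ≈ ι m * ι n
  ι-* m n rewrite ι≡×1# (m ℕ.* n) | ι≡×1# m | ι≡×1# n = ×1-homo-* m n

  sumTo-cong : ∀ n {f g : ℕ → Carrier} → (∀ k → f k ≈ g k) → sumTo n f ≈ sumTo n g
  sumTo-cong zero f≈g = f≈g 0
  sumTo-cong (suc n) f≈g = +-cong (sumTo-cong n f≈g) (f≈g (suc n))

  sumTo-+ : ∀ n (f g : ℕ → Carrier) → sumTo n (λ k → f k + g k) ≈ sumTo n f + sumTo n g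
  sumTo-+ zero f g = refl
  sumTo-+ (suc n) f g = trans (+-congʳ (sumTo-+ n f g)) (interchange _ _ _ _)

  sumTo-neg : ∀ n (f : ℕ → Carrier) → sumTo n (λ k → - f k) ≈ - sumTo n f
  sumTo-neg zero f = refl
  sumTo-neg (suc n) f = trans (+-congʳ (sumTo-neg n f)) (-‿+-comm _ _)

  *-distribˡ-sumTo : ∀ n x (f : ℕ → Carrier) → x * sumTo n f ≈ sumTo n (λ k → x * f k)
  *-distribˡ-sumTo zero x f = refl
  *-distribˡ-sumTo (suc n) x f = trans (distribˡ x _ _) (+-congʳ (*-distribˡ-sumTo n x f))

  delay : (ℕ → Carrier) → ℕ → Carrier
  delay f zero = 0#
  delay f (suc k) = f k

  sumTo-delay : ∀ n (f : ℕ → Carrier) → sumTo (suc n) (delay f) ≈ sumTo n f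
  sumTo-delay zero f = +-identityˡ (f 0)
  sumTo-delay (suc n) f = +-congʳ (sumTo-delay n f)

  scaleByIndex : (ℕ → Carrier) → ℕ → Carrier
  scaleByIndex f k = ι k * f k

  transform : (ℕ → Carrier) → ℕ → Carrier
  transform f n = sumTo n (λ k → sgn k * (ι (n C k) * f k))

  transform-cong : ∀ n {f g : ℕ → Carrier} → (∀ k → f k ≈ g k) → transform f n ≈ transform g n
  transform-cong n f≈g = sumTo-cong n (λ k → *-congˡ (*-congˡ (f≈g k)))

  transform-+ : ∀ n (f g : ℕ → Carrier) → transform (λ k → f k + g k) n ≈ transform f n + transform g n
  transform-+ n f g = trans (sumTo-cong n summand-+) (sumTo-+ n _ _)
    where
    summand-+ : ∀ k → sgn k * (ι (n C k) * (f k + g k)) ≈ sgn k * (ι (n C k) * f k) + sgn k * (ι (n C k) * g k)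
    summand-+ k = trans (*-congˡ (distribˡ _ _ _)) (distribˡ _ _ _)

  transform-pascal : ∀ n f → transform f (suc n) ≈ transform f n - transform (f ∘ suc) n
  transform-pascal n f = begin
    transform f (suc n)                          ≈⟨ sumTo-cong (suc n) pascal-summand ⟩
    sumTo (suc n) (λ k → h k + delay h′ k)       ≈⟨ sumTo-+ (suc n) h (delay h′) ⟩
    (transform f n + h (suc n)) + sumTo (suc n) (delay h′) ≈⟨ +-cong (+-congˡ h[n+1]≈0) (sumTo-delay n h′) ⟩
    (transform f n + 0#) + sumTo n h′            ≈⟨ +-cong (+-identityʳ _) (sumTo-neg n _) ⟩
    transform f n - transform (f ∘ suc) n        ∎
    where
    h h′ : ℕ → Carrier
    h k = sgn k * (ι (n C k) * f k)
    h′ k = - (sgn k * (ι (n C k) * f (suc k)))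
    h[n+1]≈0 : h (suc n) ≈ 0#
    h[n+1]≈0 rewrite k>n⇒nCk≡0 (ℕₚ.n<1+n n) = trans (*-congˡ (zeroˡ _)) (zeroʳ _)
    pascal-summand : ∀ k → sgn k * (ι (suc n C k) * f k) ≈ h k + delay h′ k
    pascal-summand zero = sym (+-identityʳ _)
    pascal-summand (suc k) rewrite ≡.sym (nCk+nC[k+1]≡[n+1]C[k+1] n k) = begin
      - s * (ι (n C k ℕ.+ n C suc k) * x)     ≈⟨ *-congˡ (*-congʳ (ι-+ (n C k) _)) ⟩
      - s * ((a + b) * x)                     ≈⟨ *-congˡ (distribʳ x a b) ⟩
      - s * (a * x + b * x)                   ≈⟨ distribˡ (- s) _ _ ⟩
      - s * (a * x) + - s * (b * x)           ≈⟨ +-comm _ _ ⟩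
      - s * (b * x) + - s * (a * x)           ≈⟨ +-congˡ (-‿distribˡ-* s _) ⟨
      - s * (b * x) + - (s * (a * x))         ∎
      where
      s = sgn k
      x = f (suc k)
      a = ι (n C k)
      b = ι (n C suc k)

  transform-delay : ∀ n f → transform (delay f) (suc n) ≈ - sumTo n (transform f)
  transform-delay zero f = begin
    transform (delay f) 1                    ≈⟨ transform-pascal 0 (delay f) ⟩
    sgn 0 * (ι 1 * 0#) - transform f 0       ≈⟨ +-congʳ (trans (*-congˡ (zeroʳ _)) (zeroʳ _)) ⟩
    0# - transform f 0                       ≈⟨ +-identityˡ _ ⟩
    - transform f 0                          ∎
  transform-delay (suc n) f = begin
    transform (delay f) (2 ℕ.+ n)                         ≈⟨ transform-pascal (suc n) (delay f) ⟩
    transform (delay f) (suc n) - transform f (suc n)     ≈⟨ +-congʳ (transform-delay n f) ⟩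
    - sumTo n (transform f) - transform f (suc n)         ≈⟨ -‿+-comm _ _ ⟩
    - sumTo (suc n) (transform f)                         ∎

  transform-antidifference : ∀ n {w d : ℕ → Carrier} → (∀ k → w (suc k) ≈ w k + d k) →
                             transform w (suc n) ≈ - transform d n
  transform-antidifference n {w} {d} Δw≈d = begin
    transform w (suc n)                                  ≈⟨ transform-pascal n w ⟩
    transform w n - transform (w ∘ suc) n                ≈⟨ +-congˡ (-‿cong (transform-cong n Δw≈d)) ⟩
    transform w n - transform (λ k → w k + d k) n        ≈⟨ +-congˡ (-‿cong (transform-+ n w d)) ⟩
    transform w n - (transform w n + transform d n)      ≈⟨ +-congˡ (-‿+-comm _ _) ⟨
    transform w n + (- transform w n - transform d n)    ≈⟨ \\-leftDividesˡ _ _ ⟩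
    - transform d n                                      ∎

  transform-scaleByIndex : ∀ n f → transform (scaleByIndex f) (suc n) ≈ - (ι (suc n) * transform (f ∘ suc) n)
  transform-scaleByIndex n f = begin
    transform (scaleByIndex f) (suc n)             ≈⟨ sumTo-cong (suc n) absorb ⟩
    sumTo (suc n) (delay (λ k → - g k))            ≈⟨ sumTo-delay n _ ⟩
    sumTo n (λ k → - g k)                          ≈⟨ sumTo-neg n g ⟩
    - sumTo n g                                    ≈⟨ -‿cong (*-distribˡ-sumTo n _ _) ⟨
    - (ι (suc n) * transform (f ∘ suc) n)          ∎
    where
    g : ℕ → Carrier
    g k = ι (suc n) * (sgn k * (ι (n C k) * f (suc k)))
    absorb : ∀ k → sgn k * (ι (suc n C k) * scaleByIndex f k) ≈ delay (λ j → - g j) k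
    absorb zero = trans (*-congˡ (trans (*-congˡ (zeroˡ _)) (zeroʳ _))) (zeroʳ _)
    absorb (suc k) = begin
      - s * (A * (I * x))      ≈⟨ -‿distribˡ-* s _ ⟨
      - (s * (A * (I * x)))    ≈⟨ -‿cong (*-congˡ (x∙yz≈yx∙z A I x)) ⟩
      - (s * ((I * A) * x))    ≈⟨ -‿cong (*-congˡ (*-congʳ I*A≈N*b)) ⟩
      - (s * ((N * b) * x))    ≈⟨ -‿cong (*-congˡ (*-assoc N b x)) ⟩
      - (s * (N * (b * x)))    ≈⟨ -‿cong (x∙yz≈y∙xz s N _) ⟩
      - (N * (s * (b * x)))    ∎
      where
      s = sgn k
      x = f (suc k)
      A = ι (suc n C suc k)
      I = ι (suc k)
      N = ι (suc n)
      b = ι (n C k)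
      I*A≈N*b : I * A ≈ N * b
      I*A≈N*b = begin
        I * A                              ≈⟨ ι-* (suc k) (suc n C suc k) ⟨
        ι (suc k ℕ.* (suc n C suc k))      ≡⟨ ≡.cong ι ([k+1]*[n+1]C[k+1]≡[n+1]*nCk n k) ⟩
        ι (suc n ℕ.* (n C k))              ≈⟨ ι-* (suc n) (n C k) ⟩
        N * b                              ∎

  transform-scaleByIndex-delay² : ∀ n f →
    ι (2 ℕ.+ n) * (ι (suc n) * transform f n) ≈ transform (scaleByIndex (delay (scaleByIndex (delay f)))) (2 ℕ.+ n)
  transform-scaleByIndex-delay² n f = begin
    ι (2 ℕ.+ n) * (ι (suc n) * transform f n)      ≈⟨ *-congˡ (-‿involutive _) ⟨
    ι (2 ℕ.+ n) * - - (ι (suc n) * transform f n)  ≈⟨ *-congˡ (-‿cong (transform-scaleByIndex n (delay f))) ⟨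
    ι (2 ℕ.+ n) * - transform g (suc n)            ≈⟨ -‿distribʳ-* _ _ ⟨
    - (ι (2 ℕ.+ n) * transform g (suc n))          ≈⟨ transform-scaleByIndex (suc n) (delay g) ⟨
    transform (scaleByIndex (delay g)) (2 ℕ.+ n)   ∎
    where
    g : ℕ → Carrier
    g = scaleByIndex (delay f)

  partialSums : (ℕ → Carrier) → ℕ → Carrier
  partialSums t k = sumTo k t

  transform-delay²-partialSums : ∀ n t → transform (delay (delay (partialSums t))) (2 ℕ.+ n) ≈ sumTo n (transform t)
  transform-delay²-partialSums n t = begin
    transform (delay (delay (partialSums t))) (2 ℕ.+ n)  ≈⟨ transform-antidifference (suc n) increment ⟩
    - transform (delay t) (suc n)                      ≈⟨ -‿cong (transform-delay n t) ⟩
    - - sumTo n (transform t)                          ≈⟨ -‿involutive _ ⟩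
    sumTo n (transform t)                              ∎
    where
    increment : ∀ k → delay (partialSums t) k ≈ delay (delay (partialSums t)) k + delay t k
    increment zero = sym (+-identityʳ 0#)
    increment (suc zero) = sym (+-identityˡ (t 0))
    increment (suc (suc k)) = refl

  module _ (inv : ℕ → Carrier) (inv*ι≈1 : ∀ n → inv n * ι (suc n) ≈ 1#) where

    avg-weights-cancel : ∀ n x → (inv n * inv (suc n)) * (ι (2 ℕ.+ n) * (ι (suc n) * x)) ≈ x
    avg-weights-cancel n x = begin
      (i₀ * i₁) * (j₂ * (j₁ * x))     ≈⟨ *-congˡ (x∙yz≈yx∙z j₂ j₁ x) ⟩
      (i₀ * i₁) * ((j₁ * j₂) * x)     ≈⟨ *-assoc _ _ x ⟨
      ((i₀ * i₁) * (j₁ * j₂)) * x     ≈⟨ *-congʳ (*-interchange i₀ i₁ j₁ j₂) ⟩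
      ((i₀ * j₁) * (i₁ * j₂)) * x     ≈⟨ *-congʳ (*-cong (inv*ι≈1 n) (inv*ι≈1 (suc n))) ⟩
      (1# * 1#) * x                   ≈⟨ *-congʳ (*-identityˡ 1#) ⟩
      1# * x                          ≈⟨ *-identityˡ x ⟩
      x                               ∎
      where
      i₀ = inv n
      i₁ = inv (suc n)
      j₁ = ι (suc n)
      j₂ = ι (2 ℕ.+ n)

    scaleByIndex-delay²-avg : ∀ t k →
      scaleByIndex (delay (scaleByIndex (delay (avg inv t)))) k ≈ delay (delay (partialSums t)) k
    scaleByIndex-delay²-avg t zero = zeroˡ _
    scaleByIndex-delay²-avg t (suc zero) = trans (*-congˡ (zeroˡ _)) (zeroʳ _)
    scaleByIndex-delay²-avg t (suc (suc k)) = begin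
      ι (2 ℕ.+ k) * (ι (suc k) * (w * S))      ≈⟨ *-congˡ (x∙yz≈y∙xz _ w S) ⟩
      ι (2 ℕ.+ k) * (w * (ι (suc k) * S))      ≈⟨ x∙yz≈y∙xz _ w _ ⟩
      w * (ι (2 ℕ.+ k) * (ι (suc k) * S))      ≈⟨ avg-weights-cancel k S ⟩
      S                                        ∎
      where
      w = inv k * inv (suc k)
      S = partialSums t k

theorem16 : {c ℓ : Level} (R : CommutativeRing c ℓ) →
    let open CommutativeRing R hiding (zero) in
    let open BinomialDefs R in
    (inv : ℕ → Carrier) → (∀ n → inv n * ι (suc n) ≈ 1#) →
    (t τ : ℕ → Carrier) → IsBinomialPair t τ →
    IsBinomialPair (avg inv t) (avg inv τ)
theorem16 R inv inv*ι≈1 t τ τ≈Tt n = begin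
  w * sumTo n τ                                                ≈⟨ *-congˡ (sumTo-cong n τ≈Tt) ⟩
  w * sumTo n (transform t)                                    ≈⟨ *-congˡ (transform-delay²-partialSums n t) ⟨
  w * transform (delay (delay (partialSums t))) (2 ℕ.+ n)      ≈⟨ *-congˡ (transform-cong (2 ℕ.+ n) (scaleByIndex-delay²-avg inv inv*ι≈1 t)) ⟨
  w * transform (scaleByIndex (delay (scaleByIndex (delay a)))) (2 ℕ.+ n) ≈⟨ *-congˡ (transform-scaleByIndex-delay² n a) ⟨
  w * (ι (2 ℕ.+ n) * (ι (suc n) * transform a n))              ≈⟨ avg-weights-cancel inv inv*ι≈1 n _ ⟩
  transform a n                                                ∎
  where
  open CommutativeRing R hiding (zero)
  open BinomialDefs R
  open BinomialTransform R
  open import Relation.Binary.Reasoning.Setoid setoid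
  a = avg inv t
  w = inv n * inv (suc n)
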